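{- Let $n\ge 1$. For each seed $s\in\{0,1,\ldots,n!-1\}$ let $\mathcal{P}_n(s)$ be the permutation of $\{1,\ldots,n\}$ produced by the algorithm described in the context. Then the map $s\mapsto \mathcal{P}_n(s)$ is a bijection from $\{0,1,\ldots,n!-1\}$ onto the set of all permutations of $\{1,\ldots,n\}$.
   Context: Algorithm: given $n\ge1$ and an integer seed $s$ with $0\le s\le n!-1$, set $d_{n+1}=0$ and for $k=n,n-1,\ldots,1$ (in this order) compute $x_k=\left\lfloor \frac{s \bmod k!}{(k-1)!}\right\rfloor$, $d_k=\left\lfloor \frac{\left\lfloor \frac{s+d_{k+1}(k+1)!}{k!}\right\rfloor \bmod (k+1)^2}{k+2}\right\rfloor$, $f_{k-1}=\left(x_k-\left\lfloor \frac{s}{k!}\right\rfloor-d_k\right)\bmod k$ (so $0\le f_{k-1}\le k-1$). The output is the factoradic sequence $f_{n-1}f_{n-2}\cdots f_0$, which is converted to a permutation of the list $(1,2,\ldots,n)$ as follows: remove the element with index $f_{n-1}$ (indices starting at $0$) from the current ordered list of remaining objects and place it first; then remove the element with index $f_{n-2}$ from the re-indexed remaining list and place it second; and so on through $f_0$ (which is always $0$). The resulting arrangement is $\mathcal{P}_n(s)$. For example, with $n=4$, $\mathcal{P}_4(4)$ has factoradic sequence $0\,2\,0\,0$ and equals $1\,4\,2\,3$. -}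

module Defs where

open import Data.Nat using (ℕ; zero; suc; _+_; _*_; _∸_; _^_; _!; _/_; _%_)
open import Data.Nat.Properties using (_!≢0)
open import Data.Integer using (ℤ; +_; _-_)
open import Data.Integer.DivMod using (_%ℕ_)
open import Data.List using (List; []; _∷_; map; upTo)
open import Data.Product using (_×_; _,_)

-- One step of the algorithm for index k ≥ 1 (written k = suc k'), given d_{k+1}.
-- Returns (d_k , f_{k-1}).
step : (s k' dNext : ℕ) → ℕ × ℕ
step s k' dNext = dk , fk
  where
    k : ℕ
    k = suc k'
    instance
      nzk : _
      nzk = k !≢0
      nzk' : _
      nzk' = k' !≢0
    xk : ℕ
    xk = (s % (k !)) / (k' !)
    dk : ℕ
    dk = (((s + dNext * (suc k) !) / (k !)) % (suc k ^ 2)) / suc (suc k)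
    fk : ℕ
    fk = ((+ xk - + (s / (k !))) - + dk) %ℕ k

-- go s k dNext: runs the loop for indices k, k-1, …, 1 (dNext = d_{k+1}),
-- producing the factoradic digits f_{k-1} f_{k-2} … f_0.
go : (s k dNext : ℕ) → List ℕ
go s zero dNext = []
go s (suc k') dNext with step s k' dNext
... | dk , fk = fk ∷ go s k' dk

factoradic : (n s : ℕ) → List ℕ
factoradic n s = go s n 0

-- Remove the element at (0-based) index i from a list, returning it and the rest.
-- (The out-of-range case never arises for the algorithm; it returns 0 and the list.)
removeAt : ℕ → List ℕ → ℕ × List ℕ
removeAt i [] = 0 , []
removeAt zero (x ∷ xs) = x , xs
removeAt (suc i) (x ∷ xs) with removeAt i xs
... | y , ys = y , x ∷ ys

decode : List ℕ → List ℕ → List ℕ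
decode [] objs = []
decode (f ∷ fs) objs with removeAt f objs
... | y , rest = y ∷ decode fs rest

oneToN : ℕ → List ℕ
oneToN n = map suc (upTo n)

P : (n s : ℕ) → List ℕ
P n s = decode (factoradic n s) (oneToN n)

module Submission where

-- The seed-to-permutation map is the composite of two bijections.
--
-- (1) Lehmer decoding.  Call a digit list f_{m-1} … f_0 a Lehmer code of
--     length m when f_i ≤ i.  Repeatedly removing the element at index f_i
--     from a duplicate-free list xs of length m ('decode') is a bijection
--     from Lehmer codes of length m onto the rearrangements of xs.
--
-- (2) The digit algorithm.  Write a seed as s = q·k! + x·(k-1)! + t with
--     x < k and t < (k-1)!.  Then x_k = x and ⌊s/k!⌋ = q, and d_k depends
--     only on q and d_{k+1}; so the emitted digit f_{k-1} = (x - q - d_k) mod k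
--     is the k-digit x shifted by an amount independent of x and t, and the
--     remaining steps see the seed (q·k + x)·(k-1)! + t.  Since a shift
--     x ↦ (x - c) mod k permutes {0,…,k-1}, induction on k shows that for
--     every prefix q and carry D, r ↦ go (q·k! + r) k D is a bijection from
--     {0,…,k!-1} onto the Lehmer codes of length k.
--
-- The main theorem takes q = D = 0 in (2) and composes with (1).

open import Defs
open import Data.Nat using (ℕ; _≤_; _<_; _!)
open import Data.List using (List)
open import Data.Product using (_×_; Σ)
open import Data.List.Relation.Binary.Permutation.Propositional using (_↭_)
open import Relation.Binary.PropositionalEquality using (_≡_)

open import Data.Nat using (suc; zero; _+_; _*_; _/_; _%_; _^_; NonZero; z≤n; s≤s)
open import Data.Nat.Properties
open import Data.Nat.DivMod
open import Data.Nat.Divisibility using (divides)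
open import Data.Nat.Tactic.RingSolver renaming (solve-∀ to ℕ-solve-∀)
open import Data.List using ([]; _∷_; length; map; upTo)
open import Data.List.Properties using (∷-injective; length-map; length-applyUpTo)
open import Data.List.Membership.Propositional using (_∈_)
open import Data.List.Relation.Unary.Any using (here; there)
import Data.List.Relation.Unary.All as All
open import Data.List.Relation.Unary.AllPairs using (_∷_)
open import Data.List.Relation.Unary.Unique.Propositional using (Unique; [])
open import Data.List.Relation.Unary.Unique.Propositional.Properties using (map⁺; upTo⁺)
open import Data.List.Relation.Binary.Permutation.Propositional using (↭-refl; ↭-prep; ↭-swap; ↭-trans; ↭-sym)
open import Data.List.Relation.Binary.Permutation.Propositional.Properties using (∈-resp-↭; drop-∷; ↭-empty-inv)
open import Data.Product using (_,_; proj₁; proj₂)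
open import Data.Empty using (⊥-elim)
open import Data.Sum using (inj₁; inj₂)
open import Data.Integer as ℤ using (ℤ; +_)
import Data.Integer.Properties as ℤ
open import Data.Integer.DivMod using (_%ℕ_; _/ℕ_; n%ℕd<d; a≡a%ℕn+[a/ℕn]*n)
open import Data.Integer.Tactic.RingSolver renaming (solve-∀ to ℤ-solve-∀)
open import Relation.Binary.PropositionalEquality using (refl; sym; trans; cong; cong₂; subst; subst₂; module ≡-Reasoning)

-- 'LehmerCode m fs': fs = f_{m-1} … f_0 with f_i < i + 1, i.e. the digits
-- that select an element from a remaining list of length i + 1.
data LehmerCode : ℕ → List ℕ → Set where
  []  : LehmerCode 0 []
  _∷_ : ∀ {m f fs} → f < suc m → LehmerCode m fs → LehmerCode (suc m) (f ∷ fs)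

picked : ℕ → List ℕ → ℕ
picked i xs = proj₁ (removeAt i xs)

rest : ℕ → List ℕ → List ℕ
rest i xs = proj₂ (removeAt i xs)

rest-length : ∀ i xs → i < length xs → length xs ≡ suc (length (rest i xs))
rest-length zero    (x ∷ xs) _       = refl
rest-length (suc i) (x ∷ xs) (s≤s i<) = cong suc (rest-length i xs i<)

removeAt-↭ : ∀ i xs → i < length xs → xs ↭ picked i xs ∷ rest i xs
removeAt-↭ zero    (x ∷ xs) _       = ↭-refl
removeAt-↭ (suc i) (x ∷ xs) (s≤s i<) =
  ↭-trans (↭-prep x (removeAt-↭ i xs i<)) (↭-swap x (picked i xs) ↭-refl)

picked-∈ : ∀ i xs → i < length xs → picked i xs ∈ xs
picked-∈ zero    (x ∷ xs) _       = here refl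
picked-∈ (suc i) (x ∷ xs) (s≤s i<) = there (picked-∈ i xs i<)

rest-⊆ : ∀ i xs {y} → y ∈ rest i xs → y ∈ xs
rest-⊆ zero    (x ∷ xs) y∈        = there y∈
rest-⊆ (suc i) (x ∷ xs) (here e)  = here e
rest-⊆ (suc i) (x ∷ xs) (there p) = there (rest-⊆ i xs p)

rest-unique : ∀ i xs → Unique xs → Unique (rest i xs)
rest-unique i       []       u        = []
rest-unique zero    (x ∷ xs) (_ ∷ u)  = u
rest-unique (suc i) (x ∷ xs) (x∉ ∷ u) =
  All.tabulate (λ y∈ → All.lookup x∉ (rest-⊆ i xs y∈)) ∷ rest-unique i xs u

picked-injective : ∀ i j xs → Unique xs → i < length xs → j < length xs →
                   picked i xs ≡ picked j xs → i ≡ j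
picked-injective zero    zero    _        _        _        _        _ = refl
picked-injective zero    (suc j) (x ∷ xs) (x∉ ∷ _) _        (s≤s j<) e =
  ⊥-elim (All.lookup x∉ (picked-∈ j xs j<) e)
picked-injective (suc i) zero    (x ∷ xs) (x∉ ∷ _) (s≤s i<) _        e =
  ⊥-elim (All.lookup x∉ (picked-∈ i xs i<) (sym e))
picked-injective (suc i) (suc j) (x ∷ xs) (_ ∷ u)  (s≤s i<) (s≤s j<) e =
  cong suc (picked-injective i j xs u i< j< e)

picked-surjective : ∀ {y} xs → y ∈ xs → Σ ℕ λ i → i < length xs × picked i xs ≡ y
picked-surjective (x ∷ xs) (here e)  = 0 , s≤s z≤n , sym e
picked-surjective (x ∷ xs) (there p) with picked-surjective xs p
... | i , i< , e = suc i , s≤s i< , e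

decode-↭ : ∀ {m fs} xs → LehmerCode m fs → length xs ≡ m → decode fs xs ↭ xs
decode-↭ []          []         _   = ↭-refl
decode-↭ xs@(_ ∷ _) (_∷_ {f = f} f< c) len =
  ↭-trans (↭-prep (picked f xs) (decode-↭ (rest f xs) c (suc-injective (trans (sym (rest-length f xs f<′)) len))))
          (↭-sym (removeAt-↭ f xs f<′))
  where f<′ : f < length xs
        f<′ = subst (f <_) (sym len) f<

decode-injective : ∀ {m fs gs} xs → Unique xs → LehmerCode m fs → LehmerCode m gs →
                   length xs ≡ m → decode fs xs ≡ decode gs xs → fs ≡ gs
decode-injective xs u [] [] _ _ = refl
decode-injective xs u (_∷_ {f = f} f< c) (_∷_ {f = g} g< c′) len e
  with picked-injective f g xs u (subst (f <_) (sym len) f<) (subst (g <_) (sym len) g<) (proj₁ (∷-injective e))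
... | refl = cong (f ∷_) (decode-injective (rest f xs) (rest-unique f xs u) c c′
               (suc-injective (trans (sym (rest-length f xs (subst (f <_) (sym len) f<))) len))
               (proj₂ (∷-injective e)))

decode-surjective : ∀ p xs → Unique xs → p ↭ xs →
                    Σ (List ℕ) λ fs → LehmerCode (length xs) fs × decode fs xs ≡ p
decode-surjective [] xs u p↭ with ↭-empty-inv (↭-sym p↭)
... | refl = [] , [] , refl
decode-surjective (y ∷ p) xs u p↭ with picked-surjective xs (∈-resp-↭ p↭ (here refl))
... | i , i< , refl with decode-surjective p (rest i xs) (rest-unique i xs u)
                           (drop-∷ (↭-trans p↭ (removeAt-↭ i xs i<)))
... | fs , c , e =
  i ∷ fs , subst (λ m → LehmerCode m (i ∷ fs)) (sym (rest-length i xs i<))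
                 (subst (i <_) (rest-length i xs i<) i< ∷ c) , cong (picked i xs ∷_) e

∣⊖∣< : ∀ {k m n} → m < k → n < k → ℤ.∣ m ℤ.⊖ n ∣ < k
∣⊖∣< {m = m} {n} m< n< with ≤-total m n
... | inj₁ m≤n = ≤-<-trans (≤-trans (≤-reflexive (ℤ.∣⊖∣-≤ m≤n)) (m∸n≤m n m)) n<
... | inj₂ n≤m = ≤-<-trans (≤-trans (≤-reflexive (trans (ℤ.∣m⊖n∣≡∣n⊖m∣ m n) (ℤ.∣⊖∣-≤ n≤m))) (m∸n≤m m n)) m<

-- A remainder in ℤ is determined by its congruence class: two
-- representations r + A·k = r′ + B·k with r, r′ < k agree, because
-- |r - r′| = |B - A|·k is then below k.
remainder-unique : ∀ {k r r′} (A B : ℤ) → r < k → r′ < k →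
                   + r ℤ.+ A ℤ.* + k ≡ + r′ ℤ.+ B ℤ.* + k → r ≡ r′
remainder-unique {k} {r} {r′} A B r< r′< e = ℤ.+-injective (ℤ.i-j≡0⇒i≡j (+ r) (+ r′) (ℤ.∣i∣≡0⇒i≡0 ∣r-r′∣≡0))
  where
  difference : + r ℤ.- + r′ ≡ (B ℤ.- A) ℤ.* + k
  difference = begin
    + r ℤ.- + r′                                  ≡⟨ regroup (+ r) (+ r′) A (+ k) ⟩
    (+ r ℤ.+ A ℤ.* + k) ℤ.- (+ r′ ℤ.+ A ℤ.* + k)  ≡⟨ cong (ℤ._- (+ r′ ℤ.+ A ℤ.* + k)) e ⟩
    (+ r′ ℤ.+ B ℤ.* + k) ℤ.- (+ r′ ℤ.+ A ℤ.* + k) ≡⟨ cancel (+ r′) B A (+ k) ⟩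
    (B ℤ.- A) ℤ.* + k                             ∎
    where
    open ≡-Reasoning
    regroup : ∀ R R′ A K → R ℤ.- R′ ≡ (R ℤ.+ A ℤ.* K) ℤ.- (R′ ℤ.+ A ℤ.* K)
    regroup = ℤ-solve-∀
    cancel : ∀ R′ B A K → (R′ ℤ.+ B ℤ.* K) ℤ.- (R′ ℤ.+ A ℤ.* K) ≡ (B ℤ.- A) ℤ.* K
    cancel = ℤ-solve-∀
  ∣r-r′∣<k : ℤ.∣ + r ℤ.- + r′ ∣ < k
  ∣r-r′∣<k = subst (_< k) (cong ℤ.∣_∣ (sym (ℤ.m-n≡m⊖n r r′))) (∣⊖∣< r< r′<)
  ∣B-A∣≡0 : ℤ.∣ B ℤ.- A ∣ ≡ 0
  ∣B-A∣≡0 = n<1⇒n≡0 (*-cancelʳ-< k _ 1 (subst₂ _<_ (trans (cong ℤ.∣_∣ difference) (ℤ.abs-* (B ℤ.- A) (+ k)))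
                                              (sym (*-identityˡ k)) ∣r-r′∣<k))
  ∣r-r′∣≡0 : ℤ.∣ + r ℤ.- + r′ ∣ ≡ 0
  ∣r-r′∣≡0 = trans (cong ℤ.∣_∣ difference) (trans (ℤ.abs-* (B ℤ.- A) (+ k)) (cong (_* k) ∣B-A∣≡0))

%ℕ-unique : ∀ {k} .{{_ : NonZero k}} (a : ℤ) {r} (Q : ℤ) → r < k → a ≡ + r ℤ.+ Q ℤ.* + k → a %ℕ k ≡ r
%ℕ-unique {k} a Q r< e =
  remainder-unique (a /ℕ k) Q (n%ℕd<d a k) r< (trans (sym (a≡a%ℕn+[a/ℕn]*n a k)) e)

+-divmod : ∀ m q k → + (m + q * k) ≡ + m ℤ.+ + q ℤ.* + k
+-divmod m q k = trans (ℤ.pos-+ m (q * k)) (cong (ℤ._+_ (+ m)) (ℤ.pos-* q k))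

_⊖_mod_ : ℕ → ℕ → (k : ℕ) .{{_ : NonZero k}} → ℕ
x ⊖ c mod k = (+ x ℤ.- + c) %ℕ k

⊖-mod-inverseʳ : ∀ {k} .{{_ : NonZero k}} x c → x < k → ((x ⊖ c mod k) + c) % k ≡ x
⊖-mod-inverseʳ {k} x c x< = sym (trans (sym (m<n⇒m%n≡m x<)) (%ℕ-unique (+ x) (+ q ℤ.+ Q) (m%n<n (f + c) k) representation))
  where
  open ≡-Reasoning
  f = x ⊖ c mod k
  Q = (+ x ℤ.- + c) /ℕ k
  q = (f + c) / k
  regroup : ∀ X C → X ≡ (X ℤ.- C) ℤ.+ C
  regroup = ℤ-solve-∀
  reorder : ∀ F Q K C → (F ℤ.+ Q ℤ.* K) ℤ.+ C ≡ (F ℤ.+ C) ℤ.+ Q ℤ.* K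
  reorder = ℤ-solve-∀
  collect : ∀ M q K Q → (M ℤ.+ q ℤ.* K) ℤ.+ Q ℤ.* K ≡ M ℤ.+ (q ℤ.+ Q) ℤ.* K
  collect = ℤ-solve-∀
  representation : + x ≡ + ((f + c) % k) ℤ.+ (+ q ℤ.+ Q) ℤ.* + k
  representation = begin
    + x                                          ≡⟨ regroup (+ x) (+ c) ⟩
    (+ x ℤ.- + c) ℤ.+ + c                        ≡⟨ cong (ℤ._+ + c) (a≡a%ℕn+[a/ℕn]*n (+ x ℤ.- + c) k) ⟩
    (+ f ℤ.+ Q ℤ.* + k) ℤ.+ + c                  ≡⟨ reorder (+ f) Q (+ k) (+ c) ⟩
    (+ f ℤ.+ + c) ℤ.+ Q ℤ.* + k                  ≡⟨ cong (ℤ._+ Q ℤ.* + k) (sym (ℤ.pos-+ f c)) ⟩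
    + (f + c) ℤ.+ Q ℤ.* + k                      ≡⟨ cong (λ z → + z ℤ.+ Q ℤ.* + k) (m≡m%n+[m/n]*n (f + c) k) ⟩
    + ((f + c) % k + q * k) ℤ.+ Q ℤ.* + k        ≡⟨ cong (ℤ._+ Q ℤ.* + k) (+-divmod ((f + c) % k) q k) ⟩
    (+ ((f + c) % k) ℤ.+ + q ℤ.* + k) ℤ.+ Q ℤ.* + k ≡⟨ collect (+ ((f + c) % k)) (+ q) (+ k) Q ⟩
    + ((f + c) % k) ℤ.+ (+ q ℤ.+ Q) ℤ.* + k      ∎

⊖-mod-inverseˡ : ∀ {k} .{{_ : NonZero k}} f c → f < k → ((f + c) % k) ⊖ c mod k ≡ f
⊖-mod-inverseˡ {k} f c f< = %ℕ-unique (+ m ℤ.- + c) (ℤ.- + q) f< representation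
  where
  open ≡-Reasoning
  m = (f + c) % k
  q = (f + c) / k
  regroup : ∀ M C Q K → M ℤ.- C ≡ ((M ℤ.+ Q ℤ.* K) ℤ.- C) ℤ.+ (ℤ.- Q) ℤ.* K
  regroup = ℤ-solve-∀
  cancel : ∀ F C Q K → ((F ℤ.+ C) ℤ.- C) ℤ.+ Q ℤ.* K ≡ F ℤ.+ Q ℤ.* K
  cancel = ℤ-solve-∀
  representation : + m ℤ.- + c ≡ + f ℤ.+ (ℤ.- + q) ℤ.* + k
  representation = begin
    + m ℤ.- + c                                      ≡⟨ regroup (+ m) (+ c) (+ q) (+ k) ⟩
    ((+ m ℤ.+ + q ℤ.* + k) ℤ.- + c) ℤ.+ (ℤ.- + q) ℤ.* + k ≡⟨ cong (λ z → (z ℤ.- + c) ℤ.+ (ℤ.- + q) ℤ.* + k)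
                                                           (sym (trans (cong +_ (m≡m%n+[m/n]*n (f + c) k)) (+-divmod m q k))) ⟩
    (+ (f + c) ℤ.- + c) ℤ.+ (ℤ.- + q) ℤ.* + k         ≡⟨ cong (λ z → (z ℤ.- + c) ℤ.+ (ℤ.- + q) ℤ.* + k) (ℤ.pos-+ f c) ⟩
    ((+ f ℤ.+ + c) ℤ.- + c) ℤ.+ (ℤ.- + q) ℤ.* + k     ≡⟨ cancel (+ f) (+ c) (ℤ.- + q) (+ k) ⟩
    + f ℤ.+ (ℤ.- + q) ℤ.* + k                         ∎

⊖-mod-injective : ∀ {k} .{{_ : NonZero k}} {x y} c → x < k → y < k → x ⊖ c mod k ≡ y ⊖ c mod k → x ≡ y
⊖-mod-injective {k} {x} {y} c x< y< e = begin
  x                          ≡⟨ sym (⊖-mod-inverseʳ x c x<) ⟩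
  ((x ⊖ c mod k) + c) % k    ≡⟨ cong (λ z → (z + c) % k) e ⟩
  ((y ⊖ c mod k) + c) % k    ≡⟨ ⊖-mod-inverseʳ y c y< ⟩
  y                          ∎
  where open ≡-Reasoning

-- d_k as a function of q = ⌊s/k!⌋ and d_{k+1} = D, for k = k′ + 1.
carry : (k′ q D : ℕ) → ℕ
carry k′ q D = ((q + D * suc (suc k′)) % (suc (suc k′) ^ 2)) / suc (suc (suc k′))

-- The digit f_{k-1} as the algorithm computes it from x_k, ⌊s/k!⌋ and d_k.
emitted : (k′ x q d : ℕ) → ℕ
emitted k′ x q d = ((+ x ℤ.- + q) ℤ.- + d) %ℕ suc k′

emitted-< : ∀ k′ x q d → emitted k′ x q d < suc k′
emitted-< k′ x q d = n%ℕd<d ((+ x ℤ.- + q) ℤ.- + d) (suc k′)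

emitted-shift : ∀ k′ x q d → emitted k′ x q d ≡ x ⊖ (q + d) mod suc k′
emitted-shift k′ x q d = cong (_%ℕ suc k′) (trans (twice (+ x) (+ q) (+ d)) (cong (ℤ._-_ (+ x)) (sym (ℤ.pos-+ q d))))
  where
  twice : ∀ X Q D → (X ℤ.- Q) ℤ.- D ≡ X ℤ.- (Q ℤ.+ D)
  twice = ℤ-solve-∀

[r+Qd]%d≡r : ∀ r Q d .{{_ : NonZero d}} → r < d → (r + Q * d) % d ≡ r
[r+Qd]%d≡r r Q d r< = trans ([m+kn]%n≡m%n r Q d) (m<n⇒m%n≡m r<)

[r+Qd]/d≡Q : ∀ r Q d .{{_ : NonZero d}} → r < d → (r + Q * d) / d ≡ Q
[r+Qd]/d≡Q r Q d r< = trans (+-distrib-/-∣ʳ r (divides Q refl)) (cong₂ _+_ (m<n⇒m/n≡0 r<) (m*n/n≡m Q d))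

mixed-radix-bound : ∀ {x t o p} → x < o → t < p → x * p + t < o * p
mixed-radix-bound {x} {t} {o} {p} x< t< = begin-strict
  x * p + t   <⟨ +-monoʳ-< (x * p) t< ⟩
  x * p + p   ≡⟨ +-comm (x * p) p ⟩
  suc x * p   ≤⟨ *-monoˡ-≤ p x< ⟩
  o * p       ∎
  where open ≤-Reasoning

factorial-digits : ∀ k′ r → r < suc k′ ! →
                   Σ ℕ λ x → Σ ℕ λ t → x < suc k′ × t < k′ ! × r ≡ x * k′ ! + t
factorial-digits k′ r r< =
  r / k′ ! , r % k′ ! , m<n*o⇒m/o<n r< , m%n<n r (k′ !) ,
  trans (m≡m%n+[m/n]*n r (k′ !)) (+-comm (r % k′ !) (r / k′ ! * k′ !))
  where instance _ = k′ !≢0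

go-step : ∀ k′ q D x t → x < suc k′ → t < k′ ! →
          go (q * suc k′ ! + (x * k′ ! + t)) (suc k′) D
            ≡ x ⊖ (q + carry k′ q D) mod suc k′ ∷ go ((q * suc k′ + x) * k′ ! + t) k′ (carry k′ q D)
go-step k′ q D x t x< t< =
  cong₂ _∷_ (trans (cong₂ (λ a b → emitted k′ a b (proj₁ (step s k′ D))) x-digit quotient)
                   (trans (cong (emitted k′ x q) d-carry) (emitted-shift k′ x q (carry k′ q D))))
            (cong₂ (λ a b → go a k′ b) tail-seed d-carry)
  where
  instance
    _ = k′ !≢0
    _ = suc k′ !≢0
  K = suc k′ !
  r = x * k′ ! + t
  s = q * K + r
  r<K : r < K
  r<K = mixed-radix-bound x< t<
  seed : s ≡ r + q * K
  seed = +-comm (q * K) r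
  x-digit : (s % K) / k′ ! ≡ x
  x-digit = begin
    (s % K) / k′ !             ≡⟨ cong (λ z → (z % K) / k′ !) seed ⟩
    ((r + q * K) % K) / k′ !   ≡⟨ cong (_/ k′ !) ([r+Qd]%d≡r r q K r<K) ⟩
    r / k′ !                   ≡⟨ cong (_/ k′ !) (+-comm (x * k′ !) t) ⟩
    (t + x * k′ !) / k′ !      ≡⟨ [r+Qd]/d≡Q t x (k′ !) t< ⟩
    x                          ∎
    where open ≡-Reasoning
  quotient : s / K ≡ q
  quotient = trans (cong (_/ K) seed) ([r+Qd]/d≡Q r q K r<K)
  lift : ∀ q K r D S → q * K + r + D * (S * K) ≡ r + (q + D * S) * K
  lift = ℕ-solve-∀
  d-carry : proj₁ (step s k′ D) ≡ carry k′ q D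
  d-carry = cong (λ z → (z % (suc (suc k′) ^ 2)) / suc (suc (suc k′)))
                 (trans (cong (_/ K) (lift q K r D (suc (suc k′)))) ([r+Qd]/d≡Q r (q + D * suc (suc k′)) K r<K))
  regroup : ∀ q k′ x F t → q * (F + k′ * F) + (x * F + t) ≡ (q * suc k′ + x) * F + t
  regroup = ℕ-solve-∀
  tail-seed : s ≡ (q * suc k′ + x) * k′ ! + t
  tail-seed = regroup q k′ x (k′ !) t

go-lehmer : ∀ k s D → LehmerCode k (go s k D)
go-lehmer zero     s D = []
go-lehmer (suc k′) s D =
  emitted-< k′ ((s % suc k′ !) / k′ !) (s / suc k′ !) (proj₁ (step s k′ D)) ∷ go-lehmer k′ s _
  where
  instance
    _ = k′ !≢0
    _ = suc k′ !≢0

-- For fixed prefix q and carry D, distinct r < k! give distinct outputs: the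
-- leading digits agree since the shift is injective, the rest by induction.
go-injective : ∀ k q D r r′ → r < k ! → r′ < k ! → go (q * k ! + r) k D ≡ go (q * k ! + r′) k D → r ≡ r′
go-injective zero q D r r′ r< r′< _ = trans (n<1⇒n≡0 r<) (sym (n<1⇒n≡0 r′<))
go-injective (suc k′) q D r r′ r< r′< e =
  let x  , t  , x<  , t<  , r≡  = factorial-digits k′ r  r<
      x′ , t′ , x′< , t′< , r′≡ = factorial-digits k′ r′ r′<
      c = carry k′ q D
      e′ : go (q * suc k′ ! + (x * k′ ! + t)) (suc k′) D ≡ go (q * suc k′ ! + (x′ * k′ ! + t′)) (suc k′) D
      e′ = subst₂ (λ a b → go (q * suc k′ ! + a) (suc k′) D ≡ go (q * suc k′ ! + b) (suc k′) D) r≡ r′≡ e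
      same-digit , same-tail = ∷-injective (trans (sym (go-step k′ q D x t x< t<)) (trans e′ (go-step k′ q D x′ t′ x′< t′<)))
      x≡x′ = ⊖-mod-injective (q + c) x< x′< same-digit
      t≡t′ = go-injective k′ (q * suc k′ + x) c t t′ t< t′<
               (subst (λ z → go ((q * suc k′ + x) * k′ ! + t) k′ c ≡ go ((q * suc k′ + z) * k′ ! + t′) k′ c) (sym x≡x′) same-tail)
  in trans r≡ (trans (cong₂ (λ a b → a * k′ ! + b) x≡x′ t≡t′) (sym r′≡))

-- … and every Lehmer code of length k is produced by some r < k!: choose the
-- leading digit x = (f + q + d_k) mod k, then the rest by induction.
go-surjective : ∀ k q D fs → LehmerCode k fs → Σ ℕ λ r → r < k ! × go (q * k ! + r) k D ≡ fs
go-surjective zero q D [] [] = 0 , s≤s z≤n , refl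
go-surjective (suc k′) q D (f ∷ fs) (f< ∷ c) =
  let x = (f + (q + carry k′ q D)) % suc k′
      x< = m%n<n (f + (q + carry k′ q D)) (suc k′)
      t , t< , tail≡ = go-surjective k′ (q * suc k′ + x) (carry k′ q D) fs c
  in x * k′ ! + t , mixed-radix-bound x< t< ,
     trans (go-step k′ q D x t x< t<) (cong₂ _∷_ (⊖-mod-inverseˡ f (q + carry k′ q D) f<) tail≡)

length-oneToN : ∀ n → length (oneToN n) ≡ n
length-oneToN n = trans (length-map suc (upTo n)) (length-applyUpTo (λ x → x) n)

unique-oneToN : ∀ n → Unique (oneToN n)
unique-oneToN n = map⁺ suc-injective (upTo⁺ n)

mainTheorem1 : (n : ℕ) → 1 ≤ n →
    ((s : ℕ) → s < n ! → P n s ↭ oneToN n)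
    × ((s t : ℕ) → s < n ! → t < n ! → P n s ≡ P n t → s ≡ t)
    × ((p : List ℕ) → p ↭ oneToN n → Σ ℕ (λ s → s < n ! × P n s ≡ p))
mainTheorem1 n _ = permutation , injective , surjective
  where
  permutation : (s : ℕ) → s < n ! → P n s ↭ oneToN n
  permutation s _ = decode-↭ (oneToN n) (go-lehmer n s 0) (length-oneToN n)

  injective : (s t : ℕ) → s < n ! → t < n ! → P n s ≡ P n t → s ≡ t
  injective s t s< t< e = go-injective n 0 0 s t s< t<
    (decode-injective (oneToN n) (unique-oneToN n) (go-lehmer n s 0) (go-lehmer n t 0) (length-oneToN n) e)

  surjective : (p : List ℕ) → p ↭ oneToN n → Σ ℕ (λ s → s < n ! × P n s ≡ p)
  surjective p p↭ =
    let fs , c , decoded = decode-surjective p (oneToN n) (unique-oneToN n) p↭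
        s , s< , produced = go-surjective n 0 0 fs (subst (λ m → LehmerCode m fs) (length-oneToN n) c)
    in s , s< , trans (cong (λ code → decode code (oneToN n)) produced) decoded
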